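{- If $H$ is a flower with center $u$, then $H$ is $\{u\}$-non-trivial.
   Context: All graphs are finite, simple and undirected. A graph $H$ is a flower with center $u\in V(H)$ if $H\setminus\{u\}$ is a disjoint union of paths and for each such path $P$, either $P$ has exactly $3$ vertices and $u$ is adjacent to all of them, or the neighbors of $u$ in $P$ form a subset (of size $0$, $1$ or $2$) of the endpoints of $P$. $H$ is an induced minor of $G$ if $H$ can be obtained from $G$ by deleting vertices and contracting edges. An induced minor model of $H$ in $G$ is a collection $\{X_w : w\in V(H)\}$ of pairwise disjoint non-empty subsets of $V(G)$ such that each $G[X_w]$ is connected, and for distinct $w,w'$, $X_w$ and $X_{w'}$ are joined by an edge of $G$ if and only if $ww'\in E(H)$. For $S\subseteq V(H)$, $H$ is $S$-non-trivial if for every graph $G$ having $H$ as an induced minor, there exists a model $\{X_w\}$ of $H$ in $G$ with $|X_w|=1$ for every $w\in V(H)\setminus S$. -}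

module Defs where

open import Data.Nat using (ℕ)
open import Data.Fin using (Fin)
open import Data.Bool using (Bool; true; false)
open import Data.List using (List; []; _∷_; head; last; length; concat)
open import Data.List.Relation.Unary.All using (All)
open import Data.List.Relation.Unary.Any using (Any)
open import Data.List.Membership.Propositional using (_∈_; _∉_)
open import Data.List.Relation.Unary.Unique.Propositional using (Unique)
open import Data.Maybe using (just)
open import Data.Product using (Σ; ∃; ∃-syntax; _×_; _,_)
open import Data.Sum using (_⊎_)
open import Function.Bundles using (_⇔_)
open import Relation.Binary.PropositionalEquality using (_≡_; _≢_)
open import Relation.Nullary using (¬_)

record Graph : Set where
  field
    n      : ℕ
    adj    : Fin n → Fin n → Bool
    sym    : ∀ x y → adj x y ≡ adj y x
    irrefl : ∀ x → adj x x ≡ false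
open Graph public

VSet : Graph → Set
VSet G = Fin (n G) → Bool

-- Walks in G all of whose vertices after the first satisfy X.
data WalkIn (G : Graph) (X : VSet G) : Fin (n G) → Fin (n G) → Set where
  here : ∀ {a} → WalkIn G X a a
  step : ∀ {a b c} → adj G a b ≡ true → X b ≡ true → WalkIn G X b c → WalkIn G X a c

-- G[X] is connected (connectivity of the induced subgraph; emptiness handled separately).
ConnectedIn : (G : Graph) → VSet G → Set
ConnectedIn G X = ∀ a b → X a ≡ true → X b ≡ true → WalkIn G X a b

Touching : (G : Graph) → VSet G → VSet G → Set
Touching G X Y = ∃[ a ] ∃[ b ] (X a ≡ true × Y b ≡ true × adj G a b ≡ true)

record Model (H G : Graph) : Set where
  field
    X         : Fin (n H) → VSet G
    nonempty  : ∀ w → ∃[ v ] (X w v ≡ true)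
    disjoint  : ∀ w w' v → w ≢ w' → X w v ≡ true → X w' v ≡ false
    connected : ∀ w → ConnectedIn G (X w)
    edges     : ∀ w w' → w ≢ w' → (Touching G (X w) (X w') ⇔ (adj H w w' ≡ true))
open Model public

InducedMinor : Graph → Graph → Set
InducedMinor H G = Model H G

Singleton : (G : Graph) → VSet G → Set
Singleton G Y = ∃[ v ] (∀ x → (Y x ≡ true) ⇔ (x ≡ v))

NonTrivial : (H : Graph) → (Fin (n H) → Set) → Set
NonTrivial H S = ∀ (G : Graph) → InducedMinor H G →
  Σ (Model H G) λ M → ∀ w → ¬ S w → Singleton G (X M w)

data Consec {A : Set} : List A → A → A → Set where
  now   : ∀ {x y xs} → Consec (x ∷ y ∷ xs) x y
  later : ∀ {z xs x y} → Consec xs x y → Consec (z ∷ xs) x y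

Endpoint : {A : Set} → List A → A → Set
Endpoint p v = head p ≡ just v ⊎ last p ≡ just v

-- H is a flower with center u: H \ {u} is the disjoint union of the paths
-- listed in 'paths' (each given by its vertex sequence), and for each path P,
-- either |P| = 3 and u is adjacent to all of P, or every neighbour of u in P
-- is an endpoint of P.
record FlowerStructure (H : Graph) (u : Fin (n H)) : Set where
  field
    paths     : List (List (Fin (n H)))
    nonemptyP : All (λ p → p ≢ []) paths
    unique    : Unique (concat paths)
    noCenter  : u ∉ concat paths
    cover     : ∀ v → v ≢ u → v ∈ concat paths
    pathEdges : ∀ x y → x ≢ u → y ≢ u →
                ((adj H x y ≡ true) ⇔ Any (λ p → Consec p x y ⊎ Consec p y x) paths)
    petals    : All (λ p → (length p ≡ 3 × All (λ v → adj H u v ≡ true) p)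
                         ⊎ (∀ v → v ∈ p → adj H u v ≡ true → Endpoint p v)) paths

IsFlower : (H : Graph) → Fin (n H) → Set
IsFlower H u = FlowerStructure H u

module Submission where

-- Every X_w with w ≠ u is made a single vertex, one petal at a time, while only X_u and the sets of
-- vertices still to be processed grow. In a petal that is a path meeting u at most in its ends, a vertex
-- w has at most two neighbours y and z₀: on a walk in X_w from a vertex seeing X_z₀ to one seeing X_y,
-- keep the last vertex r seeing X_z₀ and give the rest of the walk to X_y, with y a later vertex of the
-- path or u. In a petal w₁ w₂ w₃ fully joined to u, first shrink X_w₁ and X_w₃ to {x₁} and {x₃} this way;
-- then take an induced path from x₁ to x₃ through X_w₂ and a vertex b on it from which X_w₂ reaches X_u
-- off the path. The new w₂ is b, the new w₁ and w₃ are its two neighbours on the path, and everything else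
-- of the path, together with the way from b to X_u, joins X_u.

open import Defs hiding (sym)
open import Data.Bool using (Bool; true; false; _∨_)
open import Data.Bool.Properties using (∨-identityʳ) renaming (_≟_ to _≟ᵇ_)
open import Data.Empty using (⊥; ⊥-elim)
open import Data.Fin using (Fin)
open import Data.Fin.Properties using (_≟_; any?)
open import Data.List using (List; []; _∷_; _++_; [_]; head; last; length; concat)
open import Data.List.Properties using (++-assoc; ++-identityʳ)
open import Data.List.Membership.Propositional using (_∈_; _∉_)
open import Data.List.Membership.Propositional.Properties using (∈-++⁺ˡ; ∈-++⁺ʳ; ∈-++⁻; ∈-concat⁺; ∈-concat⁺′)
import Data.List.Membership.DecPropositional as DecMembership
open import Data.List.Relation.Binary.Subset.Propositional using (_⊆_)
open import Data.List.Relation.Unary.All as All using (All; []; _∷_)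
open import Data.List.Relation.Unary.Any as Any using (Any; here; there)
open import Data.List.Relation.Unary.AllPairs as AllPairs using ([]; _∷_)
open import Data.List.Relation.Unary.Unique.Propositional using (Unique)
open import Data.Maybe using (Maybe; just; nothing)
open import Data.Maybe.Properties using (just-injective)
open import Data.Nat using (ℕ; zero; suc; _≤_; _<_; s≤s)
open import Data.Nat.Properties using (≤-trans; ≤-refl; ≤-pred; n<1+n; <⇒≤; m≤n⇒m≤1+n)
open import Data.Product using (Σ; ∃-syntax; _×_; _,_; proj₁; proj₂)
open import Data.Sum using (_⊎_; inj₁; inj₂; [_,_]′; map₂)
open import Function.Base using (_∘_; case_of_)
open import Function.Bundles using (_⇔_; mk⇔; Equivalence)
open import Function.Properties.Equivalence using () renaming (trans to ⇔-trans)
open import Relation.Binary.PropositionalEquality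
  using (_≡_; _≢_; _≗_; refl; sym; trans; subst; ≢-sym)
open import Relation.Nullary using (¬_; Dec; yes; no; does)
open import Relation.Nullary.Decidable using (_×-dec_; dec-true)
open import Relation.Unary using (Decidable)
open Equivalence

witness : ∀ {A : Set} (a? : Dec A) → does a? ≡ true → A
witness (yes a) _ = a

≡true⇒≢false : ∀ {b} → b ≡ true → ¬ b ≡ false
≡true⇒≢false refl ()

≡⇒⇔true : ∀ {b b′} → b ≡ b′ → (b ≡ true ⇔ b′ ≡ true)
≡⇒⇔true b≡b′ = mk⇔ (trans (sym b≡b′)) (trans b≡b′)

≢true⇒≡false : ∀ {b} → ¬ b ≡ true → b ≡ false
≢true⇒≡false {true} b≢true = ⊥-elim (b≢true refl)
≢true⇒≡false {false} _ = refl

∨-trueˡ : ∀ {a b} → a ≡ true → a ∨ b ≡ true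
∨-trueˡ refl = refl

∨-trueʳ : ∀ a {b} → b ≡ true → a ∨ b ≡ true
∨-trueʳ false refl = refl
∨-trueʳ true refl = refl

∨-true⁻ : ∀ a {b} → a ∨ b ≡ true → a ≡ true ⊎ b ≡ true
∨-true⁻ true _ = inj₁ refl
∨-true⁻ false b≡true = inj₂ b≡true

adj-sym : ∀ (G : Graph) {a b} → adj G a b ≡ true → adj G b a ≡ true
adj-sym G {a} {b} e = trans (Graph.sym G b a) e

module Walks (G : Graph) where

  V : Set
  V = Fin (n G)

  _⊆ᵛ_ : VSet G → VSet G → Set
  X ⊆ᵛ Y = ∀ v → X v ≡ true → Y v ≡ true

  ｛_｝ : V → VSet G
  ｛ r ｝ v = does (v ≟ r)

  ∈｛｝⁻ : ∀ {r v} → ｛ r ｝ v ≡ true → v ≡ r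
  ∈｛｝⁻ {r} {v} = witness (v ≟ r)

  ∈｛｝ : ∀ r → ｛ r ｝ r ≡ true
  ∈｛｝ r = dec-true (r ≟ r) refl

  ｛｝-singleton : ∀ {Y : VSet G} r → Y ≗ ｛ r ｝ → Singleton G Y
  ｛｝-singleton r Y≗r = r , λ v → mk⇔ (λ e → ∈｛｝⁻ {r} {v} (trans (sym (Y≗r v)) e))
                                       (λ { refl → trans (Y≗r v) (∈｛｝ v) })

  open DecMembership (_≟_ {n G}) using (_∈?_)

  _∈ᵇ_ : V → List V → Bool
  v ∈ᵇ ts = does (v ∈? ts)

  ∈ᵇ⁻ : ∀ {v ts} → v ∈ᵇ ts ≡ true → v ∈ ts
  ∈ᵇ⁻ {v} {ts} = witness (v ∈? ts)

  ∈ᵇ⁺ : ∀ {v ts} → v ∈ ts → v ∈ᵇ ts ≡ true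
  ∈ᵇ⁺ {v} {ts} = dec-true (v ∈? ts)

  walk-mono : ∀ {X Y} → X ⊆ᵛ Y → ∀ {a b} → WalkIn G X a b → WalkIn G Y a b
  walk-mono X⊆Y here = here
  walk-mono X⊆Y (step e x w) = step e (X⊆Y _ x) (walk-mono X⊆Y w)

  walk-++ : ∀ {X a b c} → WalkIn G X a b → WalkIn G X b c → WalkIn G X a c
  walk-++ here w′ = w′
  walk-++ (step e x w) w′ = step e x (walk-++ w w′)

  walk-reverse : ∀ {X a b} → X a ≡ true → WalkIn G X a b → WalkIn G X b a
  walk-reverse = go here
    where
      go : ∀ {X s a b} → WalkIn G X a s → X a ≡ true → WalkIn G X a b → WalkIn G X b s
      go acc xa here = acc
      go acc xa (step e x w) = go (step (adj-sym G e) xa acc) x w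

  connected-cong : ∀ {X Y} → Y ≗ X → ConnectedIn G X → ConnectedIn G Y
  connected-cong Y≗X cX a b ya yb =
    walk-mono (λ v e → trans (Y≗X v) e) (cX a b (trans (sym (Y≗X a)) ya) (trans (sym (Y≗X b)) yb))

  connected-via : ∀ {B S} → ConnectedIn G B → B ⊆ᵛ S →
                  (∀ v → S v ≡ true → Σ V λ b → B b ≡ true × WalkIn G S v b) → ConnectedIn G S
  connected-via cB B⊆S reach a c sa sc with reach a sa | reach c sc
  ... | ba , Bba , wa | bc , Bbc , wc =
    walk-++ wa (walk-++ (walk-mono B⊆S (cB ba bc Bba Bbc)) (walk-reverse sc wc))

  ｛｝-connected : ∀ r → ConnectedIn G ｛ r ｝
  ｛｝-connected r a b ea eb with ∈｛｝⁻ {r} {a} ea | ∈｛｝⁻ {r} {b} eb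
  ... | refl | refl = here

  HasNbrIn : VSet G → V → Set
  HasNbrIn Y a = ∃[ b ] (Y b ≡ true × adj G a b ≡ true)

  hasNbrIn? : ∀ Y → Decidable (HasNbrIn Y)
  hasNbrIn? Y a = any? (λ b → (Y b ≟ᵇ true) ×-dec (adj G a b ≟ᵇ true))

  Touching-｛｝ : ∀ {x Y} → Touching G ｛ x ｝ Y ⇔ HasNbrIn Y x
  Touching-｛｝ {x} = mk⇔ (λ { (p , q , p∈ , q∈ , e) → case ∈｛｝⁻ {x} {p} p∈ of λ { refl → q , q∈ , e } })
                          (λ { (q , q∈ , e) → x , q , ∈｛｝ x , q∈ , e })

  HasNbrIn-｛｝ : ∀ {x y} → HasNbrIn ｛ y ｝ x ⇔ adj G x y ≡ true
  HasNbrIn-｛｝ {x} {y} = mk⇔ (λ { (q , q∈ , e) → case ∈｛｝⁻ {y} {q} q∈ of λ { refl → e } })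
                              (λ e → y , ∈｛｝ y , e)

  Singleton-Touching : ∀ {A B x} → Singleton G A → A x ≡ true → Touching G A B → HasNbrIn B x
  Singleton-Touching (r , is-r) x∈ (p , q , p∈ , q∈ , p~q) with to (is-r _) x∈ | to (is-r p) p∈
  ... | refl | refl = q , q∈ , p~q

  -- A path v, t₁, …, tₖ whose last vertex satisfies Q; the list holds t₁, …, tₖ.
  data PathTo (Q : V → Set) : V → List V → Set where
    done : ∀ {v} → Q v → PathTo Q v []
    via  : ∀ {v t ts} → adj G v t ≡ true → PathTo Q t ts → PathTo Q v (t ∷ ts)

  PathTo-suffix : ∀ {Q r T t} → PathTo Q r T → t ∈ T →
                  Σ (List V) λ T′ → PathTo Q t T′ × T′ ⊆ T
  PathTo-suffix (via e P) (here refl) = _ , P , there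
  PathTo-suffix (via e P) (there i) with PathTo-suffix P i
  ... | T′ , P′ , T′⊆T = T′ , P′ , λ j → there (T′⊆T j)

  PathTo⇒walk : ∀ {Y S v T} → PathTo (HasNbrIn Y) v T → All (λ t → S t ≡ true) T → Y ⊆ᵛ S →
                Σ V λ b → Y b ≡ true × WalkIn G S v b
  PathTo⇒walk (done (b , yb , e)) _ Y⊆S = b , yb , step e (Y⊆S b yb) here
  PathTo⇒walk (via e P) (st ∷ sts) Y⊆S with PathTo⇒walk P sts Y⊆S
  ... | b , yb , w = b , yb , step e st w

  PathTo-avoiding⇒[] : ∀ {P Q : V → Set} {r T} → (∀ v → Q v → P v) → PathTo Q r T → All (λ t → ¬ P t) T → T ≡ []
  PathTo-avoiding⇒[] Q⇒P (done _) _ = refl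
  PathTo-avoiding⇒[] Q⇒P (via _ (done q)) (¬p ∷ _) = ⊥-elim (¬p (Q⇒P _ q))
  PathTo-avoiding⇒[] Q⇒P (via _ P@(via _ _)) (_ ∷ ¬ps) with PathTo-avoiding⇒[] Q⇒P P ¬ps
  ... | ()

  PathTo⇒sees-∪ : ∀ {Y x L E} → PathTo (HasNbrIn Y) x L → L ⊆ E → HasNbrIn (λ v → Y v ∨ v ∈ᵇ E) x
  PathTo⇒sees-∪ (done (y , y∈ , x~y)) _ = y , ∨-trueˡ y∈ , x~y
  PathTo⇒sees-∪ {Y} (via {t = t} x~t _) L⊆E = t , ∨-trueʳ (Y t) (∈ᵇ⁺ (L⊆E (here refl))) , x~t

  ∪-connected : ∀ {Y E} → ConnectedIn G Y →
                (∀ t → t ∈ E → Σ (List V) λ T → PathTo (HasNbrIn Y) t T × T ⊆ E) →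
                ConnectedIn G (λ v → Y v ∨ v ∈ᵇ E)
  ∪-connected {Y} {E} cY reach = connected-via cY (λ v → ∨-trueˡ) reach′
    where
      reach′ : ∀ v → Y v ∨ v ∈ᵇ E ≡ true → Σ V λ b → Y b ≡ true × WalkIn G (λ v → Y v ∨ v ∈ᵇ E) v b
      reach′ v e with ∨-true⁻ (Y v) e
      ... | inj₁ yv = v , yv , here
      ... | inj₂ v∈E with reach v (∈ᵇ⁻ v∈E)
      ... | T , P , T⊆E = PathTo⇒walk P (All.tabulate (λ i → ∨-trueʳ (Y _) (∈ᵇ⁺ (T⊆E i)))) (λ b → ∨-trueˡ)

  record LastVisit (X : VSet G) (P Q : V → Set) : Set where
    constructor lastVisit
    field
      r    : V
      T    : List V
      r-P  : P r
      r-X  : X r ≡ true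
      T-X  : All (λ t → X t ≡ true) T
      T-¬P : All (λ t → ¬ P t) T
      r→Q  : PathTo Q r T

  lastVisit-on : ∀ {X P Q} → Decidable P → ∀ {a b} → X a ≡ true → WalkIn G X a b → P a → Q b →
                 LastVisit X P Q
  lastVisit-on {X} {P} {Q} P? xa w pa qb with go xa w qb
    where
      go : ∀ {a b} → X a ≡ true → WalkIn G X a b → Q b →
           LastVisit X P Q ⊎
           (¬ P a × Σ (List V) λ T → PathTo Q a T × All (λ t → X t ≡ true) T × All (λ t → ¬ P t) T)
      go {a} xa here qb with P? a
      ... | yes pa = inj₁ (lastVisit a [] pa xa [] [] (done qb))
      ... | no ¬pa = inj₂ (¬pa , [] , done qb , [] , [])
      go {a} xa (step e xa′ w) qb with go xa′ w qb
      ... | inj₁ found = inj₁ found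
      ... | inj₂ (¬pa′ , T , Q′ , tx , t¬p) with P? a
      ...   | yes pa = inj₁ (lastVisit a (_ ∷ T) pa xa (xa′ ∷ tx) (¬pa′ ∷ t¬p) (via e Q′))
      ...   | no ¬pa = inj₂ (¬pa , _ ∷ T , via e Q′ , xa′ ∷ tx , ¬pa′ ∷ t¬p)
  ... | inj₁ found = found
  ... | inj₂ (¬pa , _) = ⊥-elim (¬pa pa)

  data Chain : V → List V → Set where
    []  : ∀ {a} → Chain a []
    _∷_ : ∀ {a b bs} → adj G a b ≡ true → Chain b bs → Chain a (b ∷ bs)

  lastOf : V → List V → V
  lastOf a [] = a
  lastOf a (x ∷ xs) = lastOf x xs

  walk-vertices : ∀ {X a b} → WalkIn G X a b → List V
  walk-vertices here = []
  walk-vertices (step {b = a′} e x w) = a′ ∷ walk-vertices w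

  walk-chain : ∀ {X a b} (w : WalkIn G X a b) → Chain a (walk-vertices w)
  walk-chain here = []
  walk-chain (step e x w) = e ∷ walk-chain w

  walk-lastOf : ∀ {X a b} (w : WalkIn G X a b) → lastOf a (walk-vertices w) ≡ b
  walk-lastOf here = refl
  walk-lastOf (step e x w) = walk-lastOf w

  walk-vertices-in : ∀ {X a b} (w : WalkIn G X a b) → All (λ v → X v ≡ true) (walk-vertices w)
  walk-vertices-in here = []
  walk-vertices-in (step e x w) = x ∷ walk-vertices-in w

  data Induced : V → List V → Set where
    []  : ∀ {a} → Induced a []
    ext : ∀ {a b bs} → adj G a b ≡ true → All (λ x → adj G a x ≡ false) bs → a ∉ b ∷ bs →
          Induced b bs → Induced a (b ∷ bs)

  Induced⇒PathTo : ∀ {Q a ps} → Induced a ps → Q (lastOf a ps) → PathTo Q a ps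
  Induced⇒PathTo [] q = done q
  Induced⇒PathTo (ext e _ _ ip) q = via e (Induced⇒PathTo ip q)

  Induced-start∉ : ∀ {a ps} → Induced a ps → a ∉ ps
  Induced-start∉ [] ()
  Induced-start∉ (ext _ _ a∉ _) = a∉

  record LastSatisfying (P : V → Set) (b : V) (ys : List V) : Set where
    constructor lastSatisfying
    field
      c      : V
      cs     : List V
      c-P    : P c
      cs-¬P  : All (λ x → ¬ P x) cs
      chain  : Chain c cs
      same-lastOf : lastOf c cs ≡ lastOf b ys
      ⊆ys    : c ∷ cs ⊆ ys
      shorter : length cs < length ys

  lastSatisfying? : ∀ {P} → Decidable P → ∀ {b} ys → Chain b ys → LastSatisfying P b ys ⊎ All (λ x → ¬ P x) ys
  lastSatisfying? P? [] [] = inj₂ []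
  lastSatisfying? P? (x ∷ xs) (e ∷ ch) with lastSatisfying? P? xs ch
  ... | inj₁ (lastSatisfying c cs pc cs¬P chc same ⊆xs len) =
    inj₁ (lastSatisfying c cs pc cs¬P chc same (λ i → there (⊆xs i)) (m≤n⇒m≤1+n len))
  ... | inj₂ xs¬P with P? x
  ...   | yes px = inj₁ (lastSatisfying x xs px xs¬P ch refl (λ i → i) (n<1+n _))
  ...   | no ¬px = inj₂ (¬px ∷ xs¬P)

  ShortcutOf : V → List V → Set
  ShortcutOf a xs = Σ (List V) λ ys → Induced a ys × lastOf a ys ≡ lastOf a xs × ys ⊆ xs

  -- From a, jump to its last occurrence in the chain and from there to its last neighbour; what is left
  -- is induced. The fuel f bounds the length of the chain.
  shortcut : (f : ℕ) → ∀ a xs → Chain a xs → length xs ≤ f → ShortcutOf a xs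
  shortcut-from∉ : (f : ℕ) → ∀ a xs → Chain a xs → a ∉ xs → length xs ≤ f → ShortcutOf a xs

  shortcut f a xs ch len with lastSatisfying? (_≟ a) xs ch
  ... | inj₁ (lastSatisfying c cs refl cs¬a chc same ⊆xs len′)
    with shortcut-from∉ f c cs chc (λ i → All.lookup cs¬a i refl) (≤-trans (<⇒≤ len′) len)
  ...   | ys , ip , same′ , ys⊆cs = ys , ip , trans same′ same , λ i → ⊆xs (there (ys⊆cs i))
  shortcut f a xs ch len | inj₂ xs¬a = shortcut-from∉ f a xs ch (λ i → All.lookup xs¬a i refl) len

  shortcut-from∉ f a [] ch a∉ len = [] , [] , refl , λ ()
  shortcut-from∉ zero a (y ∷ ys) ch a∉ ()
  shortcut-from∉ (suc f) a (y ∷ ys) (e ∷ ch) a∉ (s≤s len)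
    with lastSatisfying? (λ v → adj G a v ≟ᵇ true) (y ∷ ys) (e ∷ ch)
  ... | inj₂ (¬e ∷ _) = ⊥-elim (¬e e)
  ... | inj₁ (lastSatisfying c cs ac cs¬a chc same ⊆xs len′)
    with shortcut f c cs chc (≤-trans (≤-pred len′) len)
  ...   | zs , ip , same′ , zs⊆cs =
    c ∷ zs , ext ac (All.tabulate (λ i → ≢true⇒≡false (All.lookup cs¬a (zs⊆cs i)))) a∉c∷zs ip ,
    trans same′ same , c∷zs⊆xs
    where
      c∷zs⊆xs : c ∷ zs ⊆ y ∷ ys
      c∷zs⊆xs (here refl) = ⊆xs (here refl)
      c∷zs⊆xs (there i) = ⊆xs (there (zs⊆cs i))
      a∉c∷zs : a ∉ c ∷ zs
      a∉c∷zs i = a∉ (c∷zs⊆xs i)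

  walk⇒induced : ∀ {X a b} (w : WalkIn G X a b) →
                 Σ (List V) λ ys → Induced a ys × lastOf a ys ≡ b × All (λ v → X v ≡ true) ys
  walk⇒induced w with shortcut _ _ (walk-vertices w) (walk-chain w) ≤-refl
  ... | ys , ip , same , ys⊆ =
    ys , ip , trans same (walk-lastOf w) , All.tabulate (λ i → All.lookup (walk-vertices-in w) (ys⊆ i))

  record Split (Q : V → Set) (F : List V) (b : V) : Set where
    field
      a c     : V
      La Lc   : List V
      a~b     : adj G a b ≡ true
      b~c     : adj G b c ≡ true
      a≁c     : adj G a c ≡ false
      a≢b     : a ≢ b
      b≢c     : b ≢ c
      a≢c     : a ≢ c
      a→Q     : PathTo Q a La
      c→Q     : PathTo Q c Lc
      a∉La    : a ∉ La
      b∉La    : b ∉ La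
      c∉La    : c ∉ La
      a∉Lc    : a ∉ Lc
      b∉Lc    : b ∉ Lc
      c∉Lc    : c ∉ Lc
      a∈F     : a ∈ F
      c∈F     : c ∈ F
      La⊆F    : La ⊆ F
      Lc⊆F    : Lc ⊆ F

  -- acc is the already traversed part of the path, reversed, so that it leads from x back to Q.
  split : ∀ {Q F b} x ps acc → Induced x ps → Q (lastOf x ps) → PathTo Q x acc →
          All (λ v → v ∉ x ∷ ps) acc → x ∈ F → ps ⊆ F → acc ⊆ F → b ∈ ps → b ≢ lastOf x ps → Split Q F b
  split {b = b} x (y ∷ ps) acc (ext x~y x≁ x∉ ip) q x→Q acc∉ x∈F ps⊆F acc⊆F b∈ b≢last with b ≟ y
  split x (y ∷ []) acc (ext x~y x≁ x∉ ip) q x→Q acc∉ x∈F ps⊆F acc⊆F b∈ b≢last | yes refl =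
    ⊥-elim (b≢last refl)
  split x (y ∷ z ∷ ps) acc (ext x~y x≁ x∉ (ext y~z y≁ y∉ ip)) q x→Q acc∉ x∈F ps⊆F acc⊆F b∈ b≢last | yes refl =
    record
      { a = x ; c = z ; La = acc ; Lc = ps
      ; a~b = x~y ; b~c = y~z ; a≁c = All.lookup x≁ (here refl)
      ; a≢b = λ e → x∉ (here e) ; b≢c = λ e → y∉ (here e) ; a≢c = λ e → x∉ (there (here e))
      ; a→Q = x→Q ; c→Q = Induced⇒PathTo ip q
      ; a∉La = λ i → All.lookup acc∉ i (here refl)
      ; b∉La = λ i → All.lookup acc∉ i (there (here refl))
      ; c∉La = λ i → All.lookup acc∉ i (there (there (here refl)))
      ; a∉Lc = λ i → x∉ (there (there i)) ; b∉Lc = λ i → y∉ (there i) ; c∉Lc = Induced-start∉ ip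
      ; a∈F = x∈F ; c∈F = ps⊆F (there (here refl)) ; La⊆F = acc⊆F ; Lc⊆F = λ i → ps⊆F (there (there i))
      }
  ... | no b≢y with b∈
  ...   | here b≡y = ⊥-elim (b≢y b≡y)
  ...   | there b∈ps =
    split y ps (x ∷ acc) ip q (via (adj-sym G x~y) x→Q)
          (x∉ ∷ All.map (λ v∉ i → v∉ (there i)) acc∉)
          (ps⊆F (here refl)) (λ i → ps⊆F (there i)) acc⊆F′ b∈ps b≢last
    where
      acc⊆F′ : x ∷ acc ⊆ _
      acc⊆F′ (here refl) = x∈F
      acc⊆F′ (there i) = acc⊆F i

module Lists {A : Set} where

  Unique-++⁻ : ∀ (xs : List A) {ys} → Unique (xs ++ ys) → Unique xs × Unique ys × (∀ {x} → x ∈ xs → x ∉ ys)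
  Unique-++⁻ [] u = [] , u , λ ()
  Unique-++⁻ (x ∷ xs) (x∉ ∷ u) with Unique-++⁻ xs u
  ... | uxs , uys , disjoint = All.tabulate (λ i → All.lookup x∉ (∈-++⁺ˡ i)) ∷ uxs , uys , disjoint′
    where
      disjoint′ : ∀ {z} → z ∈ x ∷ xs → z ∉ _
      disjoint′ (here refl) j = All.lookup x∉ (∈-++⁺ʳ xs j) refl
      disjoint′ (there i) j = disjoint i j

  Unique-concat⁻ : ∀ {p} (qs : List (List A)) → Unique (concat qs) → p ∈ qs → Unique p
  Unique-concat⁻ (q ∷ qs) u (here refl) = proj₁ (Unique-++⁻ q u)
  Unique-concat⁻ (q ∷ qs) u (there i) = Unique-concat⁻ qs (proj₁ (proj₂ (Unique-++⁻ q u))) i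

  -- In a list of pairwise disjoint lists, w determines the list containing it.
  Any-owner : ∀ {C : List A → Set} {w p} (qs : List (List A)) → Unique (concat qs) → p ∈ qs → w ∈ p →
              Any C qs → (∀ p′ → C p′ → w ∈ p′) → C p
  Any-owner (q ∷ qs) u (here refl) w∈p (here c) owns = c
  Any-owner (q ∷ qs) u (here refl) w∈p (there any) owns =
    ⊥-elim (proj₂ (proj₂ (Unique-++⁻ q u)) w∈p (∈-concat⁺ (Any.map (owns _) any)))
  Any-owner (q ∷ qs) u (there p∈) w∈p (here c) owns =
    ⊥-elim (proj₂ (proj₂ (Unique-++⁻ q u)) (owns q c) (∈-concat⁺′ w∈p p∈))
  Any-owner (q ∷ qs) u (there p∈) w∈p (there any) owns =
    Any-owner qs (proj₁ (proj₂ (Unique-++⁻ q u))) p∈ w∈p any owns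

  Consec⇒∈ˡ : ∀ {xs : List A} {a b} → Consec xs a b → a ∈ xs
  Consec⇒∈ˡ now = here refl
  Consec⇒∈ˡ (later c) = there (Consec⇒∈ˡ c)

  Consec⇒∈ʳ : ∀ {xs : List A} {a b} → Consec xs a b → b ∈ xs
  Consec⇒∈ʳ now = there (here refl)
  Consec⇒∈ʳ (later c) = there (Consec⇒∈ʳ c)

  Consec-∷⁻ : ∀ {x : A} {zs a b} → Consec (x ∷ zs) a b → (a ≡ x × head zs ≡ just b) ⊎ Consec zs a b
  Consec-∷⁻ now = inj₁ (refl , refl)
  Consec-∷⁻ (later c) = inj₂ c

  head⇒∈ : ∀ {xs : List A} {q} → head xs ≡ just q → q ∈ xs
  head⇒∈ {x ∷ xs} refl = here refl

  last⇒∈ : ∀ {xs : List A} {q} → last xs ≡ just q → q ∈ xs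
  last⇒∈ {x ∷ []} refl = here refl
  last⇒∈ {x ∷ xs@(_ ∷ _)} e = there (last⇒∈ {xs} e)

  last-++-∷ : ∀ (pre : List A) {w x rest} → last (pre ++ w ∷ x ∷ rest) ≡ last (x ∷ rest)
  last-++-∷ [] = refl
  last-++-∷ (y ∷ []) = refl
  last-++-∷ (y ∷ pre@(_ ∷ _)) = last-++-∷ pre

  Consec-next : ∀ (pre : List A) {w rest z} → w ∉ pre → w ∉ rest → Consec (pre ++ w ∷ rest) w z →
                head rest ≡ just z
  Consec-next [] w∉pre w∉rest c with Consec-∷⁻ c
  ... | inj₁ (_ , h) = h
  ... | inj₂ c′ = ⊥-elim (w∉rest (Consec⇒∈ˡ c′))
  Consec-next (x ∷ pre) w∉pre w∉rest c with Consec-∷⁻ c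
  ... | inj₁ (refl , _) = ⊥-elim (w∉pre (here refl))
  ... | inj₂ c′ = Consec-next pre (λ i → w∉pre (there i)) w∉rest c′

  Consec-prev : ∀ (pre : List A) {w rest z} → w ∉ pre → w ∉ rest → Consec (pre ++ w ∷ rest) z w →
                last pre ≡ just z
  Consec-prev [] w∉pre w∉rest c with Consec-∷⁻ c
  ... | inj₁ (_ , h) = ⊥-elim (w∉rest (head⇒∈ h))
  ... | inj₂ c′ = ⊥-elim (w∉rest (Consec⇒∈ʳ c′))
  Consec-prev (x ∷ []) w∉pre w∉rest now = refl
  Consec-prev (x ∷ []) w∉pre w∉rest (later c) with Consec-prev [] (λ ()) w∉rest c
  ... | ()
  Consec-prev (x ∷ y ∷ pre) w∉pre w∉rest now = ⊥-elim (w∉pre (there (here refl)))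
  Consec-prev (x ∷ y ∷ pre) w∉pre w∉rest (later c) = Consec-prev (y ∷ pre) (λ i → w∉pre (there i)) w∉rest c

  last-Consec : ∀ (pre : List A) {q w rest} → last pre ≡ just q → Consec (pre ++ w ∷ rest) q w
  last-Consec (x ∷ []) refl = now
  last-Consec (x ∷ pre@(_ ∷ _)) e = later (last-Consec pre e)

  head-Consec : ∀ (pre : List A) {w rest x} → head rest ≡ just x → Consec (pre ++ w ∷ rest) w x
  head-Consec [] {rest = _ ∷ _} refl = now
  head-Consec (y ∷ pre) h = later (head-Consec pre h)

  Endpoint-split : ∀ (pre : List A) {w rest} → w ∉ pre → w ∉ rest → Endpoint (pre ++ w ∷ rest) w →
                   pre ≡ [] ⊎ rest ≡ []
  Endpoint-split [] _ _ _ = inj₁ refl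
  Endpoint-split (x ∷ pre) w∉pre _ (inj₁ refl) = ⊥-elim (w∉pre (here refl))
  Endpoint-split (x ∷ pre) {rest = []} _ _ (inj₂ _) = inj₂ refl
  Endpoint-split (x ∷ pre) {rest = y ∷ rest} _ w∉rest (inj₂ e) =
    ⊥-elim (w∉rest (last⇒∈ (trans (sym (last-++-∷ (x ∷ pre))) e)))

module Models (H G : Graph) where
  open Walks G public

  VH : Set
  VH = Fin (n H)

  Faithful : VSet G → VSet G → VH → VH → Set
  Faithful A B z z′ = Touching G A B ⇔ adj H z z′ ≡ true

  Touching-sym : ∀ {A B} → Touching G A B → Touching G B A
  Touching-sym (a , b , xa , xb , e) = b , a , xb , xa , adj-sym G e

  Faithful-sym : ∀ {A B z z′} → Faithful A B z z′ → Faithful B A z′ z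
  Faithful-sym f = mk⇔ (λ t → adj-sym H (to f (Touching-sym t))) (λ e → Touching-sym (from f (adj-sym H e)))

  Touching-cong : ∀ {A A′ B B′} → A ≗ A′ → B ≗ B′ → Touching G A B → Touching G A′ B′
  Touching-cong A≗ B≗ (a , b , xa , xb , e) = a , b , trans (sym (A≗ a)) xa , trans (sym (B≗ b)) xb , e

  Faithful-cong : ∀ {A A′ B B′ z z′} → A ≗ A′ → B ≗ B′ → Faithful A′ B′ z z′ → Faithful A B z z′
  Faithful-cong A≗ B≗ f =
    ⇔-trans (mk⇔ (Touching-cong A≗ B≗) (Touching-cong (λ v → sym (A≗ v)) (λ v → sym (B≗ v)))) f

  ｛｝-faithful : ∀ {x y z z′} → adj G x y ≡ adj H z z′ → Faithful ｛ x ｝ ｛ y ｝ z z′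
  ｛｝-faithful eq = ⇔-trans (⇔-trans Touching-｛｝ HasNbrIn-｛｝) (≡⇒⇔true eq)

  Singleton-cong : ∀ {A B} → A ≗ B → Singleton G B → Singleton G A
  Singleton-cong A≗B (r , f) = r , λ x → mk⇔ (λ e → to (f x) (trans (sym (A≗B x)) e))
                                             (λ e → trans (A≗B x) (from (f x) e))

  disjoint-at : (M : Model H G) → ∀ {z z′ v} → z ≢ z′ → X M z v ≡ true → X M z′ v ≡ false
  disjoint-at M = disjoint M _ _ _

  _[_≔_] : (VH → VSet G) → VH → VSet G → VH → VSet G
  (Y [ w ≔ S ]) z with z ≟ w
  ... | yes _ = S
  ... | no _ = Y z

  ≔-same : ∀ Y w S → (Y [ w ≔ S ]) w ≗ S
  ≔-same Y w S v with w ≟ w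
  ... | yes _ = refl
  ... | no w≢w = ⊥-elim (w≢w refl)

  ≔-other : ∀ Y {w z} S → z ≢ w → (Y [ w ≔ S ]) z ≗ Y z
  ≔-other Y {w} {z} S z≢w v with z ≟ w
  ... | yes z≡w = ⊥-elim (z≢w z≡w)
  ... | no _ = refl

-- How X_w connects to X_y after shrinking: through the path T, or not at all.
Link : (H G : Graph) → Model H G → (w y : Fin (n H)) → Fin (n G) → List (Fin (n G)) → Set
Link H G M w y r T =
  (adj H w y ≡ true × Walks.PathTo G (Walks.HasNbrIn G (X M y)) r T) ⊎ (T ≡ [] × adj H w y ≡ false)

-- X_w shrinks to one of its vertices r and a part T of X_w moves to X_y.
module ShrinkToPoint (H G : Graph) (M : Model H G) (w y : Fin (n H)) (y≢w : y ≢ w)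
  (r : Fin (n G)) (r∈Xw : X M w r ≡ true) (T : List (Fin (n G)))
  (T⊆Xw : All (λ t → X M w t ≡ true) T) (r∉T : r ∉ T)
  (link : Link H G M w y r T)
  (T-nbrs : ∀ t z → t ∈ T → z ≢ w → z ≢ y → Walks.HasNbrIn G (X M z) t → adj H y z ≡ true)
  (r-nbrs : ∀ z → z ≢ w → z ≢ y → adj H w z ≡ true → Walks.HasNbrIn G (X M z) r) where

  open Models H G

  Y′ : VSet G
  Y′ v = X M y v ∨ v ∈ᵇ T

  X′ : VH → VSet G
  X′ = (X M [ y ≔ Y′ ]) [ w ≔ ｛ r ｝ ]

  X′w : X′ w ≗ ｛ r ｝
  X′w = ≔-same _ w ｛ r ｝

  X′y : X′ y ≗ Y′
  X′y v = trans (≔-other _ ｛ r ｝ y≢w v) (≔-same (X M) y Y′ v)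

  X′-other : ∀ z → z ≢ w → z ≢ y → X′ z ≗ X M z
  X′-other z z≢w z≢y v = trans (≔-other _ ｛ r ｝ z≢w v) (≔-other (X M) Y′ z≢y v)

  data Role (z : VH) : Set where
    is-w  : z ≡ w → Role z
    is-y  : z ≡ y → Role z
    other : z ≢ w → z ≢ y → Role z

  role : ∀ z → Role z
  role z with z ≟ w | z ≟ y
  ... | yes z≡w | _ = is-w z≡w
  ... | no _ | yes z≡y = is-y z≡y
  ... | no z≢w | no z≢y = other z≢w z≢y

  w≢y : w ≢ y
  w≢y = ≢-sym y≢w

  ∈X′w⁻ : ∀ {v} → X′ w v ≡ true → v ≡ r
  ∈X′w⁻ {v} e = ∈｛｝⁻ {r} {v} (trans (sym (X′w v)) e)

  ∈X′y⁻ : ∀ {v} → X′ y v ≡ true → X M y v ≡ true ⊎ v ∈ T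
  ∈X′y⁻ {v} e with ∨-true⁻ (X M y v) (trans (sym (X′y v)) e)
  ... | inj₁ p = inj₁ p
  ... | inj₂ m = inj₂ (∈ᵇ⁻ m)

  r∈X′w : X′ w r ≡ true
  r∈X′w = trans (X′w r) (∈｛｝ r)

  nonempty′ : ∀ z → ∃[ v ] (X′ z v ≡ true)
  nonempty′ z with role z
  ... | is-w refl = r , r∈X′w
  ... | is-y refl = let v , e = nonempty M y in v , trans (X′y v) (∨-trueˡ e)
  ... | other z≢w z≢y = let v , e = nonempty M z in v , trans (X′-other z z≢w z≢y v) e

  r∉X′ : ∀ {z} → z ≢ w → X′ z r ≢ true
  r∉X′ {z} z≢w e with role z
  ... | is-w z≡w = z≢w z≡w
  ... | is-y refl = [ (λ p → ≡true⇒≢false p (disjoint-at M w≢y r∈Xw)) , r∉T ]′ (∈X′y⁻ e)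
  ... | other _ z≢y = ≡true⇒≢false (trans (sym (X′-other z z≢w z≢y r)) e) (disjoint-at M (≢-sym z≢w) r∈Xw)

  ∈X′y⇒∉other : ∀ {z v} → z ≢ w → z ≢ y → X′ y v ≡ true → X M z v ≡ false
  ∈X′y⇒∉other z≢w z≢y e with ∈X′y⁻ e
  ... | inj₁ p = disjoint-at M (≢-sym z≢y) p
  ... | inj₂ i = disjoint-at M (≢-sym z≢w) (All.lookup T⊆Xw i)

  disjoint′ : ∀ z z′ v → z ≢ z′ → X′ z v ≡ true → X′ z′ v ≡ false
  disjoint′ z z′ v z≢z′ e = ≢true⇒≡false (clash (role z) (role z′))
    where
      clash : Role z → Role z′ → X′ z′ v ≢ true
      clash (is-w refl) (is-w refl) _ = z≢z′ refl
      clash (is-y refl) (is-y refl) _ = z≢z′ refl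
      clash (is-w refl) _ e′ with ∈X′w⁻ e
      ... | refl = r∉X′ (≢-sym z≢z′) e′
      clash _ (is-w refl) e′ with ∈X′w⁻ e′
      ... | refl = r∉X′ z≢z′ e
      clash (is-y refl) (other z′≢w z′≢y) e′ =
        ≡true⇒≢false (trans (sym (X′-other z′ z′≢w z′≢y v)) e′) (∈X′y⇒∉other z′≢w z′≢y e)
      clash (other z≢w z≢y) (is-y refl) e′ =
        ≡true⇒≢false (trans (sym (X′-other z z≢w z≢y v)) e) (∈X′y⇒∉other z≢w z≢y e′)
      clash (other z≢w z≢y) (other z′≢w z′≢y) e′ =
        ≡true⇒≢false (trans (sym (X′-other z′ z′≢w z′≢y v)) e′)
                     (disjoint-at M z≢z′ (trans (sym (X′-other z z≢w z≢y v)) e))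

  connected-y : Link H G M w y r T → ConnectedIn G (X′ y)
  connected-y (inj₁ (_ , r→Y)) = connected-cong X′y (∪-connected (connected M y) (λ t i → PathTo-suffix r→Y i))
  connected-y (inj₂ (refl , _)) = connected-cong (λ v → trans (X′y v) (∨-identityʳ (X M y v))) (connected M y)

  connected′ : ∀ z → ConnectedIn G (X′ z)
  connected′ z with role z
  ... | is-w refl = connected-cong X′w (｛｝-connected r)
  ... | is-y refl = connected-y link
  ... | other z≢w z≢y = connected-cong (X′-other z z≢w z≢y) (connected M z)

  faithful-w-y : Link H G M w y r T → Faithful (X′ w) (X′ y) w y
  faithful-w-y l = mk⇔ (fwd l) (bwd l)
    where
      fwd : Link H G M w y r T → Touching G (X′ w) (X′ y) → adj H w y ≡ true
      fwd l (a , b , xa , xb , e) with ∈X′w⁻ xa | ∈X′y⁻ xb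
      ... | refl | inj₁ p = to (edges M w y w≢y) (a , b , r∈Xw , p , e)
      fwd (inj₁ (w~y , _)) _ | refl | inj₂ _ = w~y
      fwd (inj₂ (refl , _)) _ | refl | inj₂ ()
      bwd : Link H G M w y r T → adj H w y ≡ true → Touching G (X′ w) (X′ y)
      bwd (inj₂ (_ , w≁y)) w~y = ⊥-elim (≡true⇒≢false w~y w≁y)
      bwd (inj₁ (_ , done (b , yb , e))) _ = r , b , r∈X′w , trans (X′y b) (∨-trueˡ yb) , e
      bwd (inj₁ (_ , via {t = t} {ts} e _)) _ =
        r , t , r∈X′w , trans (X′y t) (∨-trueʳ (X M y t) (∈ᵇ⁺ {t} {t ∷ ts} (here refl))) , e

  faithful-w-other : ∀ z → z ≢ w → z ≢ y → Faithful (X′ w) (X′ z) w z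
  faithful-w-other z z≢w z≢y = mk⇔ fwd bwd
    where
      fwd : Touching G (X′ w) (X′ z) → adj H w z ≡ true
      fwd (a , b , xa , xb , e) with ∈X′w⁻ xa
      ... | refl = to (edges M w z (≢-sym z≢w)) (a , b , r∈Xw , trans (sym (X′-other z z≢w z≢y b)) xb , e)
      bwd : adj H w z ≡ true → Touching G (X′ w) (X′ z)
      bwd w~z = let b , xb , e = r-nbrs z z≢w z≢y w~z in r , b , r∈X′w , trans (X′-other z z≢w z≢y b) xb , e

  faithful-y-other : ∀ z → z ≢ w → z ≢ y → Faithful (X′ y) (X′ z) y z
  faithful-y-other z z≢w z≢y = mk⇔ fwd bwd
    where
      fwd : Touching G (X′ y) (X′ z) → adj H y z ≡ true
      fwd (a , b , xa , xb , e) with ∈X′y⁻ xa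
      ... | inj₁ p = to (edges M y z (≢-sym z≢y)) (a , b , p , trans (sym (X′-other z z≢w z≢y b)) xb , e)
      ... | inj₂ i = T-nbrs a z i z≢w z≢y (b , trans (sym (X′-other z z≢w z≢y b)) xb , e)
      bwd : adj H y z ≡ true → Touching G (X′ y) (X′ z)
      bwd y~z = let a , b , xa , xb , e = from (edges M y z (≢-sym z≢y)) y~z in
                a , b , trans (X′y a) (∨-trueˡ xa) , trans (X′-other z z≢w z≢y b) xb , e

  edges′ : ∀ z z′ → z ≢ z′ → Faithful (X′ z) (X′ z′) z z′
  edges′ z z′ z≢z′ with role z | role z′
  ... | is-w refl | is-w refl = ⊥-elim (z≢z′ refl)
  ... | is-y refl | is-y refl = ⊥-elim (z≢z′ refl)
  ... | is-w refl | is-y refl = faithful-w-y link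
  ... | is-y refl | is-w refl = Faithful-sym (faithful-w-y link)
  ... | is-w refl | other z′≢w z′≢y = faithful-w-other z′ z′≢w z′≢y
  ... | other z≢w z≢y | is-w refl = Faithful-sym (faithful-w-other z z≢w z≢y)
  ... | is-y refl | other z′≢w z′≢y = faithful-y-other z′ z′≢w z′≢y
  ... | other z≢w z≢y | is-y refl = Faithful-sym (faithful-y-other z z≢w z≢y)
  ... | other z≢w z≢y | other z′≢w z′≢y =
    Faithful-cong (X′-other z z≢w z≢y) (X′-other z′ z′≢w z′≢y) (edges M z z′ z≢z′)

  model : Model H G
  model = record
    { X = X′ ; nonempty = nonempty′ ; disjoint = disjoint′ ; connected = connected′ ; edges = edges′ }

  singleton-w : Singleton G (X′ w)
  singleton-w = ｛｝-singleton r X′w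

  unchanged-y : T ≡ [] → X′ y ≗ X M y
  unchanged-y refl v = trans (X′y v) (∨-identityʳ (X M y v))


module Shrinking (H G : Graph) where
  open Models H G

  Shrunk : Model H G → (w y z₀ : VH) → Set
  Shrunk M w y z₀ = Σ (Model H G) λ M′ → Singleton G (X M′ w)
                    × (∀ z → z ≢ w → z ≢ y → X M′ z ≗ X M z)
                    × (z₀ ≡ y → X M′ y ≗ X M y)

  shrink-deg≤2 : (M : Model H G) (w y z₀ : VH) → y ≢ w → z₀ ≢ w → adj H w y ≡ true → adj H w z₀ ≡ true →
                 (∀ z → adj H w z ≡ true → z ≡ y ⊎ z ≡ z₀) → Shrunk M w y z₀
  shrink-deg≤2 M w y z₀ y≢w z₀≢w w~y w~z₀ nbrs
    with from (edges M w z₀ (≢-sym z₀≢w)) w~z₀ | from (edges M w y (≢-sym y≢w)) w~y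
  ... | a , a′ , a∈ , a′∈ , a~a′ | b , b′ , b∈ , b′∈ , b~b′
    with lastVisit-on (hasNbrIn? (X M z₀)) a∈ (connected M w a b a∈ b∈) (a′ , a′∈ , a~a′) (b′ , b′∈ , b~b′)
  ... | lastVisit r T r-z₀ r∈ T⊆Xw T-¬z₀ r→y =
    S.model , S.singleton-w , S.X′-other , λ z₀≡y → S.unchanged-y (T-empty z₀≡y)
    where
      T-nbrs : ∀ t z → t ∈ T → z ≢ w → z ≢ y → HasNbrIn (X M z) t → adj H y z ≡ true
      T-nbrs t z i z≢w z≢y (s , s∈ , t~s)
        with nbrs z (to (edges M w z (≢-sym z≢w)) (t , s , All.lookup T⊆Xw i , s∈ , t~s))
      ... | inj₁ z≡y = ⊥-elim (z≢y z≡y)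
      ... | inj₂ refl = ⊥-elim (All.lookup T-¬z₀ i (s , s∈ , t~s))
      r-nbrs : ∀ z → z ≢ w → z ≢ y → adj H w z ≡ true → HasNbrIn (X M z) r
      r-nbrs z z≢w z≢y w~z with nbrs z w~z
      ... | inj₁ z≡y = ⊥-elim (z≢y z≡y)
      ... | inj₂ refl = r-z₀
      T-empty : z₀ ≡ y → T ≡ []
      T-empty refl = PathTo-avoiding⇒[] (λ _ q → q) r→y T-¬z₀
      r∉T : r ∉ T
      r∉T i = All.lookup T-¬z₀ i r-z₀
      module S = ShrinkToPoint H G M w y y≢w r r∈ T T⊆Xw r∉T (inj₁ (w~y , r→y)) T-nbrs r-nbrs

  -- y is a bystander: with T = [] and w isolated, X_y stays as it is.
  shrink-isolated : (M : Model H G) (w y : VH) → y ≢ w → (∀ z → adj H w z ≡ false) →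
                    Σ (Model H G) λ M′ → Singleton G (X M′ w) × (∀ z → z ≢ w → X M′ z ≗ X M z)
  shrink-isolated M w y y≢w isolated with nonempty M w
  ... | r , r∈ = S.model , S.singleton-w , unchanged
    where
      r-nbrs : ∀ z → z ≢ w → z ≢ y → adj H w z ≡ true → HasNbrIn (X M z) r
      r-nbrs z _ _ w~z = ⊥-elim (≡true⇒≢false w~z (isolated z))
      module S = ShrinkToPoint H G M w y y≢w r r∈ [] [] (λ ()) (inj₂ (refl , isolated y)) (λ _ _ ()) r-nbrs
      unchanged : ∀ z → z ≢ w → X S.model z ≗ X M z
      unchanged z z≢w with z ≟ y
      ... | yes refl = S.unchanged-y refl
      ... | no z≢y = S.X′-other z z≢w z≢y

record Triangle (H : Graph) (u : Fin (n H)) : Set where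
  field
    w₁ w₂ w₃ : Fin (n H)
    w₁≢w₂    : w₁ ≢ w₂
    w₁≢w₃    : w₁ ≢ w₃
    w₂≢w₃    : w₂ ≢ w₃
    w₁≢u     : w₁ ≢ u
    w₂≢u     : w₂ ≢ u
    w₃≢u     : w₃ ≢ u
    w₁~w₂    : adj H w₁ w₂ ≡ true
    w₂~w₃    : adj H w₂ w₃ ≡ true
    w₁~u     : adj H w₁ u ≡ true
    w₂~u     : adj H w₂ u ≡ true
    w₃~u     : adj H w₃ u ≡ true
    nbrs₁    : ∀ z → adj H w₁ z ≡ true → z ≡ w₂ ⊎ z ≡ u
    nbrs₂    : ∀ z → adj H w₂ z ≡ true → z ≡ w₁ ⊎ z ≡ w₃ ⊎ z ≡ u
    nbrs₃    : ∀ z → adj H w₃ z ≡ true → z ≡ w₂ ⊎ z ≡ u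

  w₁≁w₃ : adj H w₁ w₃ ≡ false
  w₁≁w₃ = ≢true⇒≡false λ w₁~w₃ → [ w₂≢w₃ ∘ sym , w₃≢u ]′ (nbrs₁ w₃ w₁~w₃)

  Outside : Fin (n H) → Set
  Outside z = z ≢ w₁ × z ≢ w₂ × z ≢ w₃ × z ≢ u

  outside₁ : ∀ {z} → Outside z → adj H w₁ z ≡ false
  outside₁ (z≢w₁ , z≢w₂ , z≢w₃ , z≢u) = ≢true⇒≡false λ e → [ z≢w₂ , z≢u ]′ (nbrs₁ _ e)

  outside₂ : ∀ {z} → Outside z → adj H w₂ z ≡ false
  outside₂ (z≢w₁ , z≢w₂ , z≢w₃ , z≢u) = ≢true⇒≡false λ e → [ z≢w₁ , [ z≢w₃ , z≢u ]′ ]′ (nbrs₂ _ e)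

  outside₃ : ∀ {z} → Outside z → adj H w₃ z ≡ false
  outside₃ (z≢w₁ , z≢w₂ , z≢w₃ , z≢u) = ≢true⇒≡false λ e → [ z≢w₂ , z≢u ]′ (nbrs₃ _ e)

module Petal {H : Graph} {u : Fin (n H)} (FS : FlowerStructure H u)
             {p : List (Fin (n H))} (p∈ : p ∈ FlowerStructure.paths FS) where
  open FlowerStructure FS
  open Lists

  unique-p : Unique p
  unique-p = Unique-concat⁻ paths unique p∈

  ∉centre : ∀ {w} → w ∈ p → w ≢ u
  ∉centre w∈ refl = noCenter (∈-concat⁺′ w∈ p∈)

  nbr-on-p : ∀ {w z} → w ∈ p → z ≢ u → adj H w z ≡ true → Consec p w z ⊎ Consec p z w
  nbr-on-p {w} {z} w∈ z≢u w~z = Any-owner paths unique p∈ w∈ (to (pathEdges w z (∉centre w∈) z≢u) w~z) owns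
    where
      owns : ∀ p′ → Consec p′ w z ⊎ Consec p′ z w → w ∈ p′
      owns p′ = [ Consec⇒∈ˡ , Consec⇒∈ʳ ]′

  Consec⇒adj : ∀ {a b} → Consec p a b → adj H a b ≡ true
  Consec⇒adj {a} {b} c =
    from (pathEdges a b (∉centre (Consec⇒∈ˡ c)) (∉centre (Consec⇒∈ʳ c))) (Any.map (λ { refl → inj₁ c }) p∈)

  module Position (pre : List (Fin (n H))) (w : Fin (n H)) (rest : List (Fin (n H)))
                  (eq : pre ++ w ∷ rest ≡ p) where

    unique-split : Unique pre × Unique (w ∷ rest) × (∀ {x} → x ∈ pre → x ∉ w ∷ rest)
    unique-split = Unique-++⁻ pre (subst Unique (sym eq) unique-p)

    pre∉ : ∀ {x} → x ∈ pre → x ∉ w ∷ rest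
    pre∉ = proj₂ (proj₂ unique-split)

    w∉pre : w ∉ pre
    w∉pre i = pre∉ i (here refl)

    w∉rest : w ∉ rest
    w∉rest i with proj₁ (proj₂ unique-split)
    ... | w∉ ∷ _ = All.lookup w∉ i refl

    ∈p : ∀ {z} → z ∈ pre ++ w ∷ rest → z ∈ p
    ∈p = subst (_ ∈_) eq

    Consec-p : ∀ {a b} → Consec (pre ++ w ∷ rest) a b → Consec p a b
    Consec-p = subst (λ q → Consec q _ _) eq

    w∈p : w ∈ p
    w∈p = ∈p (∈-++⁺ʳ pre (here refl))

    w≢u : w ≢ u
    w≢u = ∉centre w∈p

    nbr : ∀ z → adj H w z ≡ true → z ≡ u ⊎ last pre ≡ just z ⊎ head rest ≡ just z
    nbr z w~z with z ≟ u
    ... | yes z≡u = inj₁ z≡u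
    ... | no z≢u with nbr-on-p w∈p z≢u w~z
    ...   | inj₁ c = inj₂ (inj₂ (Consec-next pre w∉pre w∉rest (subst (λ q → Consec q _ _) (sym eq) c)))
    ...   | inj₂ c = inj₂ (inj₁ (Consec-prev pre w∉pre w∉rest (subst (λ q → Consec q _ _) (sym eq) c)))

    prev : ∀ {q} → last pre ≡ just q → q ≢ w × adj H w q ≡ true
    prev lq = (λ { refl → w∉pre (last⇒∈ lq) }) , adj-sym H (Consec⇒adj (Consec-p (last-Consec pre lq)))

    next : ∀ {x} → head rest ≡ just x → x ≢ w × adj H w x ≡ true
    next hx = (λ { refl → w∉rest (head⇒∈ hx) }) , Consec⇒adj (Consec-p (head-Consec pre hx))

  triangle : ∀ {w₁ w₂ w₃} → p ≡ w₁ ∷ w₂ ∷ w₃ ∷ [] → All (λ v → adj H u v ≡ true) p → Triangle H u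
  triangle {w₁} {w₂} {w₃} refl u~p = record
    { w₁ = w₁ ; w₂ = w₂ ; w₃ = w₃
    ; w₁≢w₂ = All.lookup (AllPairs.head unique-p) (here refl)
    ; w₁≢w₃ = All.lookup (AllPairs.head unique-p) (there (here refl))
    ; w₂≢w₃ = All.lookup (AllPairs.head (AllPairs.tail unique-p)) (here refl)
    ; w₁≢u = P₁.w≢u ; w₂≢u = P₂.w≢u ; w₃≢u = P₃.w≢u
    ; w₁~w₂ = Consec⇒adj now ; w₂~w₃ = Consec⇒adj (later now)
    ; w₁~u = adj-sym H (All.lookup u~p (here refl))
    ; w₂~u = adj-sym H (All.lookup u~p (there (here refl)))
    ; w₃~u = adj-sym H (All.lookup u~p (there (there (here refl))))
    ; nbrs₁ = λ z e → [ inj₂ , [ (λ ()) , inj₁ ∘ sym ∘ just-injective ]′ ]′ (P₁.nbr z e)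
    ; nbrs₂ = λ z e → [ inj₂ ∘ inj₂ , [ inj₁ ∘ sym ∘ just-injective , inj₂ ∘ inj₁ ∘ sym ∘ just-injective ]′ ]′
                        (P₂.nbr z e)
    ; nbrs₃ = λ z e → [ inj₂ , [ inj₁ ∘ sym ∘ just-injective , (λ ()) ]′ ]′ (P₃.nbr z e)
    }
    where
      module P₁ = Position [] w₁ (w₂ ∷ w₃ ∷ []) refl
      module P₂ = Position (w₁ ∷ []) w₂ (w₃ ∷ []) refl
      module P₃ = Position (w₁ ∷ w₂ ∷ []) w₃ [] refl

module PathPetal {H : Graph} {u : Fin (n H)} (FS : FlowerStructure H u) (G : Graph)
                 {p : List (Fin (n H))} (p∈ : p ∈ FlowerStructure.paths FS)
                 (ends : ∀ v → v ∈ p → adj H u v ≡ true → Endpoint p v) where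
  open Petal FS p∈
  open Models H G
  open Shrinking H G
  open Lists

  -- Shrinking w may enlarge X_y only: y is still to be processed, is the centre, or does not grow (z₀ ≡ y).
  record Anchors (w : VH) (rest : List VH) : Set where
    constructor anchors
    field
      y z₀   : VH
      y≢w    : y ≢ w
      z₀≢w   : z₀ ≢ w
      w~y    : adj H w y ≡ true
      w~z₀   : adj H w z₀ ≡ true
      nbrs   : ∀ z → adj H w z ≡ true → z ≡ y ⊎ z ≡ z₀
      y-free : y ∈ rest ⊎ y ≡ u ⊎ z₀ ≡ y

  module _ (pre : List VH) (w : VH) (rest : List VH) (eq : pre ++ w ∷ rest ≡ p) where
    open Position pre w rest eq

    u-at-end : adj H w u ≡ true → pre ≡ [] ⊎ rest ≡ []
    u-at-end w~u =
      Endpoint-split pre w∉pre w∉rest (subst (λ q → Endpoint q w) (sym eq) (ends w w∈p (adj-sym H w~u)))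

    at-u : ∀ {z} → adj H w u ≢ true → adj H w z ≡ true → z ≢ u
    at-u w≁u w~z refl = w≁u w~z

    same-just : ∀ {m : Maybe VH} {a b} → m ≡ just a → m ≡ just b → b ≡ a
    same-just ma mb = just-injective (trans (sym mb) ma)

    not-just : ∀ {m : Maybe VH} {b} {A : Set} → m ≡ nothing → m ≡ just b → A
    not-just m≡nothing m≡just with trans (sym m≡nothing) m≡just
    ... | ()

    anchors-or-isolated : Anchors w rest ⊎ (∀ z → adj H w z ≡ false)
    anchors-or-isolated with last pre in lp | head rest in hr | adj H w u ≟ᵇ true
    ... | just q | just x | yes w~u with u-at-end w~u
    ...   | inj₁ refl = case lp of λ ()
    ...   | inj₂ refl = case hr of λ ()
    anchors-or-isolated | just q | just x | no w≁u =
      inj₁ (anchors x q (proj₁ (next hr)) (proj₁ (prev lp)) (proj₂ (next hr)) (proj₂ (prev lp))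
                    (λ z w~z → [ ⊥-elim ∘ at-u w≁u w~z , [ inj₂ ∘ same-just lp , inj₁ ∘ same-just hr ]′ ]′
                                 (nbr z w~z))
                    (inj₁ (head⇒∈ hr)))
    anchors-or-isolated | just q | nothing | yes w~u =
      inj₁ (anchors u q (≢-sym w≢u) (proj₁ (prev lp)) w~u (proj₂ (prev lp))
                    (λ z w~z → [ inj₁ , [ inj₂ ∘ same-just lp , not-just hr ]′ ]′ (nbr z w~z))
                    (inj₂ (inj₁ refl)))
    anchors-or-isolated | just q | nothing | no w≁u =
      inj₁ (anchors q q (proj₁ (prev lp)) (proj₁ (prev lp)) (proj₂ (prev lp)) (proj₂ (prev lp))
                    (λ z w~z → [ ⊥-elim ∘ at-u w≁u w~z , [ inj₁ ∘ same-just lp , not-just hr ]′ ]′ (nbr z w~z))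
                    (inj₂ (inj₂ refl)))
    anchors-or-isolated | nothing | just x | yes w~u =
      inj₁ (anchors x u (proj₁ (next hr)) (≢-sym w≢u) (proj₂ (next hr)) w~u
                    (λ z w~z → [ inj₂ , [ not-just lp , inj₁ ∘ same-just hr ]′ ]′ (nbr z w~z))
                    (inj₁ (head⇒∈ hr)))
    anchors-or-isolated | nothing | just x | no w≁u =
      inj₁ (anchors x x (proj₁ (next hr)) (proj₁ (next hr)) (proj₂ (next hr)) (proj₂ (next hr))
                    (λ z w~z → [ ⊥-elim ∘ at-u w≁u w~z , [ not-just lp , inj₁ ∘ same-just hr ]′ ]′ (nbr z w~z))
                    (inj₁ (head⇒∈ hr)))
    anchors-or-isolated | nothing | nothing | yes w~u =
      inj₁ (anchors u u (≢-sym w≢u) (≢-sym w≢u) w~u w~u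
                    (λ z w~z → [ inj₁ , [ not-just lp , not-just hr ]′ ]′ (nbr z w~z))
                    (inj₂ (inj₁ refl)))
    anchors-or-isolated | nothing | nothing | no w≁u =
      inj₂ (λ z → ≢true⇒≡false (λ w~z → [ at-u w≁u w~z , [ not-just lp , not-just hr ]′ ]′ (nbr z w~z)))

  Shrunk-at : Model H G → VH → List VH → Set
  Shrunk-at M w rest = Σ (Model H G) λ M′ → Singleton G (X M′ w)
                       × (∀ z → z ≢ w → z ∉ rest → z ≢ u → X M′ z ≗ X M z)

  shrink-at : (M : Model H G) (pre : List VH) (w : VH) (rest : List VH) → pre ++ w ∷ rest ≡ p →
              Shrunk-at M w rest
  shrink-at M pre w rest eq with anchors-or-isolated pre w rest eq
  ... | inj₂ isolated =
    let M′ , single , same = shrink-isolated M w u (≢-sym (Position.w≢u pre w rest eq)) isolated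
    in M′ , single , λ z z≢w _ _ → same z z≢w
  ... | inj₁ (anchors y z₀ y≢w z₀≢w w~y w~z₀ nbrs y-free) =
    let M′ , single , same-other , same-y = shrink-deg≤2 M w y z₀ y≢w z₀≢w w~y w~z₀ nbrs
    in M′ , single , λ z z≢w z∉rest z≢u → unchanged {M′} {z} (same-other z z≢w) same-y z∉rest z≢u
    where
      unchanged : ∀ {M′ z} → (z ≢ y → X M′ z ≗ X M z) → (z₀ ≡ y → X M′ y ≗ X M y) → z ∉ rest → z ≢ u →
                  X M′ z ≗ X M z
      unchanged {z = z} same-other same-y z∉rest z≢u with z ≟ y
      ... | no z≢y = same-other z≢y
      ... | yes refl = [ ⊥-elim ∘ z∉rest , [ ⊥-elim ∘ z≢u , same-y ]′ ]′ y-free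

  Shrunk-all : Model H G → List VH → Set
  Shrunk-all M rest = Σ (Model H G) λ M′ → (∀ z → z ∈ p → Singleton G (X M′ z))
                      × (∀ z → z ∉ rest → z ≢ u → X M′ z ≗ X M z)

  shrink-from : (M : Model H G) (pre rest : List VH) → pre ++ rest ≡ p →
                (∀ z → z ∈ pre → Singleton G (X M z)) → Shrunk-all M rest
  shrink-from M pre [] eq pre-single =
    M , (λ z i → pre-single z (subst (z ∈_) (trans (sym eq) (++-identityʳ pre)) i)) , λ _ _ _ _ → refl
  shrink-from M pre (w ∷ rest) eq pre-single = continue (shrink-at M pre w rest eq)
    where
      open Position pre w rest eq using (w∉pre; pre∉; ∈p)
      continue : Shrunk-at M w rest → Shrunk-all M (w ∷ rest)
      continue (M₁ , w-single , same₁)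
        with shrink-from M₁ (pre ++ [ w ]) rest (trans (++-assoc pre [ w ] rest) eq) pre-single₁
        where
          pre-single₁ : ∀ z → z ∈ pre ++ [ w ] → Singleton G (X M₁ z)
          pre-single₁ z i with ∈-++⁻ pre i
          ... | inj₂ (here refl) = w-single
          ... | inj₁ j =
            Singleton-cong (same₁ z (λ { refl → w∉pre j }) (pre∉ j ∘ there) (∉centre (∈p (∈-++⁺ˡ j))))
                           (pre-single z j)
      ... | M₂ , single₂ , same₂ =
        M₂ , single₂ ,
        λ z z∉ z≢u v → trans (same₂ z (z∉ ∘ there) z≢u v) (same₁ z (z∉ ∘ here) (z∉ ∘ there) z≢u v)

module TriangleSurgery (H G : Graph) {u : Fin (n H)} (t : Triangle H u) where
  open Triangle t
  open Models H G
  open Shrinking H G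
  open DecMembership (_≟_ {n G}) using (_∈?_)

  InPetal : Model H G → V → Set
  InPetal M v = X M w₁ v ≡ true ⊎ X M w₂ v ≡ true ⊎ X M w₃ v ≡ true

  -- An induced path a b c inside the petal, and a set E of further petal vertices that joins X_u.
  record Cut (M : Model H G) : Set where
    field
      a b c    : V
      E        : List V
      a-in     : InPetal M a
      b-in     : InPetal M b
      c-in     : InPetal M c
      E-in     : All (InPetal M) E
      a~b      : adj G a b ≡ true
      b~c      : adj G b c ≡ true
      a≁c      : adj G a c ≡ false
      a≢b      : a ≢ b
      b≢c      : b ≢ c
      a≢c      : a ≢ c
      a∉E      : a ∉ E
      b∉E      : b ∉ E
      c∉E      : c ∉ E
      E→u      : ∀ t → t ∈ E → Σ (List V) λ T → PathTo (HasNbrIn (X M u)) t T × T ⊆ E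
      a-sees-u : HasNbrIn (λ v → X M u v ∨ v ∈ᵇ E) a
      b-sees-u : HasNbrIn (λ v → X M u v ∨ v ∈ᵇ E) b
      c-sees-u : HasNbrIn (λ v → X M u v ∨ v ∈ᵇ E) c

  module Surgery (M : Model H G) (cut : Cut M) where
    open Cut cut

    U′ : VSet G
    U′ v = X M u v ∨ v ∈ᵇ E

    X′ : VH → VSet G
    X′ = (((X M [ u ≔ U′ ]) [ w₃ ≔ ｛ c ｝ ]) [ w₂ ≔ ｛ b ｝ ]) [ w₁ ≔ ｛ a ｝ ]

    X′₁ : X′ w₁ ≗ ｛ a ｝
    X′₁ = ≔-same _ w₁ _

    X′₂ : X′ w₂ ≗ ｛ b ｝
    X′₂ v = trans (≔-other _ _ (w₁≢w₂ ∘ sym) v) (≔-same _ w₂ _ v)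

    X′₃ : X′ w₃ ≗ ｛ c ｝
    X′₃ v = trans (≔-other _ _ (w₁≢w₃ ∘ sym) v) (trans (≔-other _ _ (w₂≢w₃ ∘ sym) v) (≔-same _ w₃ _ v))

    X′u : X′ u ≗ U′
    X′u v = trans (≔-other _ _ (w₁≢u ∘ sym) v) (trans (≔-other _ _ (w₂≢u ∘ sym) v)
              (trans (≔-other _ _ (w₃≢u ∘ sym) v) (≔-same (X M) u _ v)))

    X′-outside : ∀ {z} → Outside z → X′ z ≗ X M z
    X′-outside (z≢w₁ , z≢w₂ , z≢w₃ , z≢u) v = trans (≔-other _ _ z≢w₁ v) (trans (≔-other _ _ z≢w₂ v)
                                                 (trans (≔-other _ _ z≢w₃ v) (≔-other (X M) _ z≢u v)))

    data Role (z : VH) : Set where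
      is₁     : z ≡ w₁ → Role z
      is₂     : z ≡ w₂ → Role z
      is₃     : z ≡ w₃ → Role z
      is-u    : z ≡ u → Role z
      outside : Outside z → Role z

    role : ∀ z → Role z
    role z with z ≟ w₁ | z ≟ w₂ | z ≟ w₃ | z ≟ u
    ... | yes e | _ | _ | _ = is₁ e
    ... | no _ | yes e | _ | _ = is₂ e
    ... | no _ | no _ | yes e | _ = is₃ e
    ... | no _ | no _ | no _ | yes e = is-u e
    ... | no z≢w₁ | no z≢w₂ | no z≢w₃ | no z≢u = outside (z≢w₁ , z≢w₂ , z≢w₃ , z≢u)

    in-petal⇒∉ : ∀ {z v} → z ≢ w₁ → z ≢ w₂ → z ≢ w₃ → InPetal M v → X M z v ≡ false
    in-petal⇒∉ z≢w₁ _ _ (inj₁ e) = disjoint-at M (≢-sym z≢w₁) e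
    in-petal⇒∉ _ z≢w₂ _ (inj₂ (inj₁ e)) = disjoint-at M (≢-sym z≢w₂) e
    in-petal⇒∉ _ _ z≢w₃ (inj₂ (inj₂ e)) = disjoint-at M (≢-sym z≢w₃) e

    in-petal⇒∉u : ∀ {v} → InPetal M v → X M u v ≡ false
    in-petal⇒∉u = in-petal⇒∉ (w₁≢u ∘ sym) (w₂≢u ∘ sym) (w₃≢u ∘ sym)

    in-petal⇒∉outside : ∀ {z v} → Outside z → InPetal M v → X M z v ≡ false
    in-petal⇒∉outside (z≢w₁ , z≢w₂ , z≢w₃ , _) = in-petal⇒∉ z≢w₁ z≢w₂ z≢w₃

    in-petal⇒no-outside-nbr : ∀ {z v x} → Outside z → InPetal M v → X M z x ≡ true → adj G v x ≡ true → ⊥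
    in-petal⇒no-outside-nbr {z} {v} {x} o@(z≢w₁ , z≢w₂ , z≢w₃ , _) v-in x∈ v~x with v-in
    ... | inj₁ e = ≡true⇒≢false (to (edges M w₁ z (≢-sym z≢w₁)) (v , x , e , x∈ , v~x)) (outside₁ o)
    ... | inj₂ (inj₁ e) = ≡true⇒≢false (to (edges M w₂ z (≢-sym z≢w₂)) (v , x , e , x∈ , v~x)) (outside₂ o)
    ... | inj₂ (inj₂ e) = ≡true⇒≢false (to (edges M w₃ z (≢-sym z≢w₃)) (v , x , e , x∈ , v~x)) (outside₃ o)

    InU′ : V → Set
    InU′ v = X M u v ≡ true ⊎ v ∈ E

    data Point (z : VH) (v : V) : Set where
      at₁ : z ≡ w₁ → v ≡ a → Point z v
      at₂ : z ≡ w₂ → v ≡ b → Point z v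
      at₃ : z ≡ w₃ → v ≡ c → Point z v

    data Who (z : VH) (v : V) : Set where
      point   : Point z v → Who z v
      centre  : z ≡ u → InU′ v → Who z v
      outside : Outside z → X M z v ≡ true → Who z v

    who : ∀ z v → X′ z v ≡ true → Who z v
    who z v e with role z
    ... | is₁ refl = point (at₁ refl (∈｛｝⁻ {a} {v} (trans (sym (X′₁ v)) e)))
    ... | is₂ refl = point (at₂ refl (∈｛｝⁻ {b} {v} (trans (sym (X′₂ v)) e)))
    ... | is₃ refl = point (at₃ refl (∈｛｝⁻ {c} {v} (trans (sym (X′₃ v)) e)))
    ... | is-u refl = centre refl (map₂ ∈ᵇ⁻ (∨-true⁻ (X M u v) (trans (sym (X′u v)) e)))
    ... | outside o = outside o (trans (sym (X′-outside o v)) e)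

    point-in : ∀ {z v} → Point z v → InPetal M v × v ∉ E
    point-in (at₁ _ refl) = a-in , a∉E
    point-in (at₂ _ refl) = b-in , b∉E
    point-in (at₃ _ refl) = c-in , c∉E

    points-agree : ∀ {z z′ v} → Point z v → Point z′ v → z ≡ z′
    points-agree (at₁ refl _) (at₁ refl _) = refl
    points-agree (at₂ refl _) (at₂ refl _) = refl
    points-agree (at₃ refl _) (at₃ refl _) = refl
    points-agree (at₁ _ refl) (at₂ _ e) = ⊥-elim (a≢b e)
    points-agree (at₁ _ refl) (at₃ _ e) = ⊥-elim (a≢c e)
    points-agree (at₂ _ refl) (at₁ _ e) = ⊥-elim (a≢b (sym e))
    points-agree (at₂ _ refl) (at₃ _ e) = ⊥-elim (b≢c e)
    points-agree (at₃ _ refl) (at₁ _ e) = ⊥-elim (a≢c (sym e))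
    points-agree (at₃ _ refl) (at₂ _ e) = ⊥-elim (b≢c (sym e))

    point∉U′ : ∀ {z v} → Point z v → ¬ InU′ v
    point∉U′ p (inj₁ x) = ≡true⇒≢false x (in-petal⇒∉u (proj₁ (point-in p)))
    point∉U′ p (inj₂ i) = proj₂ (point-in p) i

    point∉outside : ∀ {z z′ v} → Point z v → Outside z′ → X M z′ v ≢ true
    point∉outside p o x = ≡true⇒≢false x (in-petal⇒∉outside o (proj₁ (point-in p)))

    U′∉outside : ∀ {z v} → InU′ v → Outside z → X M z v ≢ true
    U′∉outside (inj₁ x) (_ , _ , _ , z≢u) y = ≡true⇒≢false y (disjoint-at M (≢-sym z≢u) x)
    U′∉outside (inj₂ i) o y = ≡true⇒≢false y (in-petal⇒∉outside o (All.lookup E-in i))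

    clash : ∀ {z z′ v} → Who z v → Who z′ v → z ≢ z′ → ⊥
    clash (point p) (point p′) z≢z′ = z≢z′ (points-agree p p′)
    clash (point p) (centre _ q) _ = point∉U′ p q
    clash (centre _ q) (point p) _ = point∉U′ p q
    clash (point p) (outside o x) _ = point∉outside p o x
    clash (outside o x) (point p) _ = point∉outside p o x
    clash (centre refl _) (centre refl _) z≢z′ = z≢z′ refl
    clash (centre _ q) (outside o x) _ = U′∉outside q o x
    clash (outside o x) (centre _ q) _ = U′∉outside q o x
    clash (outside _ x) (outside _ y) z≢z′ = ≡true⇒≢false y (disjoint-at M z≢z′ x)

    disjoint′ : ∀ z z′ v → z ≢ z′ → X′ z v ≡ true → X′ z′ v ≡ false
    disjoint′ z z′ v z≢z′ e = ≢true⇒≡false λ e′ → clash (who z v e) (who z′ v e′) z≢z′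

    nonempty′ : ∀ z → ∃[ v ] (X′ z v ≡ true)
    nonempty′ z with role z
    ... | is₁ refl = a , trans (X′₁ a) (∈｛｝ a)
    ... | is₂ refl = b , trans (X′₂ b) (∈｛｝ b)
    ... | is₃ refl = c , trans (X′₃ c) (∈｛｝ c)
    ... | is-u refl = let v , e = nonempty M u in v , trans (X′u v) (∨-trueˡ e)
    ... | outside o = let v , e = nonempty M z in v , trans (X′-outside o v) e

    connected′ : ∀ z → ConnectedIn G (X′ z)
    connected′ z with role z
    ... | is₁ refl = connected-cong X′₁ (｛｝-connected a)
    ... | is₂ refl = connected-cong X′₂ (｛｝-connected b)
    ... | is₃ refl = connected-cong X′₃ (｛｝-connected c)
    ... | is-u refl = connected-cong X′u (∪-connected (connected M u) E→u)
    ... | outside o = connected-cong (X′-outside o) (connected M z)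

    point-u-faithful : ∀ {x w} → HasNbrIn U′ x → adj H w u ≡ true → Faithful ｛ x ｝ U′ w u
    point-u-faithful x-sees w~u = ⇔-trans Touching-｛｝ (mk⇔ (λ _ → w~u) (λ _ → x-sees))

    point-outside-faithful : ∀ {x w z} → InPetal M x → Outside z → adj H w z ≡ false →
                             Faithful ｛ x ｝ (X M z) w z
    point-outside-faithful x-in o w≁z =
      ⇔-trans Touching-｛｝ (mk⇔ (λ { (_ , y∈ , x~y) → ⊥-elim (in-petal⇒no-outside-nbr o x-in y∈ x~y) })
                                 (λ w~z → ⊥-elim (≡true⇒≢false w~z w≁z)))

    u-outside-faithful : ∀ {z} → Outside z → Faithful U′ (X M z) u z
    u-outside-faithful {z} o@(_ , _ , _ , z≢u) = mk⇔ fwd bwd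
      where
        fwd : Touching G U′ (X M z) → adj H u z ≡ true
        fwd (x , y , x∈ , y∈ , x~y) with ∨-true⁻ (X M u x) x∈
        ... | inj₁ p = to (edges M u z (≢-sym z≢u)) (x , y , p , y∈ , x~y)
        ... | inj₂ m = ⊥-elim (in-petal⇒no-outside-nbr o (All.lookup E-in (∈ᵇ⁻ m)) y∈ x~y)
        bwd : adj H u z ≡ true → Touching G U′ (X M z)
        bwd u~z = let x , y , x∈ , y∈ , x~y = from (edges M u z (≢-sym z≢u)) u~z
                  in x , y , ∨-trueˡ x∈ , y∈ , x~y

    faithful₁₂ : Faithful (X′ w₁) (X′ w₂) w₁ w₂
    faithful₁₂ = Faithful-cong X′₁ X′₂ (｛｝-faithful (trans a~b (sym w₁~w₂)))

    faithful₂₃ : Faithful (X′ w₂) (X′ w₃) w₂ w₃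
    faithful₂₃ = Faithful-cong X′₂ X′₃ (｛｝-faithful (trans b~c (sym w₂~w₃)))

    faithful₁₃ : Faithful (X′ w₁) (X′ w₃) w₁ w₃
    faithful₁₃ = Faithful-cong X′₁ X′₃ (｛｝-faithful (trans a≁c (sym w₁≁w₃)))

    faithful₁u : Faithful (X′ w₁) (X′ u) w₁ u
    faithful₁u = Faithful-cong X′₁ X′u (point-u-faithful a-sees-u w₁~u)

    faithful₂u : Faithful (X′ w₂) (X′ u) w₂ u
    faithful₂u = Faithful-cong X′₂ X′u (point-u-faithful b-sees-u w₂~u)

    faithful₃u : Faithful (X′ w₃) (X′ u) w₃ u
    faithful₃u = Faithful-cong X′₃ X′u (point-u-faithful c-sees-u w₃~u)

    faithful₁o : ∀ {z} → Outside z → Faithful (X′ w₁) (X′ z) w₁ z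
    faithful₁o o = Faithful-cong X′₁ (X′-outside o) (point-outside-faithful a-in o (outside₁ o))

    faithful₂o : ∀ {z} → Outside z → Faithful (X′ w₂) (X′ z) w₂ z
    faithful₂o o = Faithful-cong X′₂ (X′-outside o) (point-outside-faithful b-in o (outside₂ o))

    faithful₃o : ∀ {z} → Outside z → Faithful (X′ w₃) (X′ z) w₃ z
    faithful₃o o = Faithful-cong X′₃ (X′-outside o) (point-outside-faithful c-in o (outside₃ o))

    faithful-uo : ∀ {z} → Outside z → Faithful (X′ u) (X′ z) u z
    faithful-uo o = Faithful-cong X′u (X′-outside o) (u-outside-faithful o)

    edges′ : ∀ z z′ → z ≢ z′ → Faithful (X′ z) (X′ z′) z z′
    edges′ z z′ z≢z′ with role z | role z′
    ... | is₁ refl | is₁ refl = ⊥-elim (z≢z′ refl)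
    ... | is₂ refl | is₂ refl = ⊥-elim (z≢z′ refl)
    ... | is₃ refl | is₃ refl = ⊥-elim (z≢z′ refl)
    ... | is-u refl | is-u refl = ⊥-elim (z≢z′ refl)
    ... | is₁ refl | is₂ refl = faithful₁₂
    ... | is₂ refl | is₃ refl = faithful₂₃
    ... | is₁ refl | is₃ refl = faithful₁₃
    ... | is₂ refl | is₁ refl = Faithful-sym faithful₁₂
    ... | is₃ refl | is₂ refl = Faithful-sym faithful₂₃
    ... | is₃ refl | is₁ refl = Faithful-sym faithful₁₃
    ... | is₁ refl | is-u refl = faithful₁u
    ... | is₂ refl | is-u refl = faithful₂u
    ... | is₃ refl | is-u refl = faithful₃u
    ... | is-u refl | is₁ refl = Faithful-sym faithful₁u
    ... | is-u refl | is₂ refl = Faithful-sym faithful₂u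
    ... | is-u refl | is₃ refl = Faithful-sym faithful₃u
    ... | is₁ refl | outside o = faithful₁o o
    ... | is₂ refl | outside o = faithful₂o o
    ... | is₃ refl | outside o = faithful₃o o
    ... | outside o | is₁ refl = Faithful-sym (faithful₁o o)
    ... | outside o | is₂ refl = Faithful-sym (faithful₂o o)
    ... | outside o | is₃ refl = Faithful-sym (faithful₃o o)
    ... | is-u refl | outside o = faithful-uo o
    ... | outside o | is-u refl = Faithful-sym (faithful-uo o)
    ... | outside o | outside o′ = Faithful-cong (X′-outside o) (X′-outside o′) (edges M z z′ z≢z′)

    model : Model H G
    model = record
      { X = X′ ; nonempty = nonempty′ ; disjoint = disjoint′ ; connected = connected′ ; edges = edges′ }

  Triangulated : Model H G → Set
  Triangulated M = Σ (Model H G) λ M′ → Singleton G (X M′ w₁) × Singleton G (X M′ w₂) × Singleton G (X M′ w₃)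
                   × (∀ {z} → Outside z → X M′ z ≗ X M z)

  surgery : (M : Model H G) → Cut M → Triangulated M
  surgery M cut = model , ｛｝-singleton a X′₁ , ｛｝-singleton b X′₂ , ｛｝-singleton c X′₃ , X′-outside
    where
      open Cut cut
      open Surgery M cut

  -- x₁ ps is an induced path from x₁ ∈ X_w₁ through X_w₂ to x₃ ∈ X_w₃, and b is a vertex of it from
  -- which Lb leads through X_w₂, off the path, to X_u; cutting the path at b gives the triangle a b c.
  module Assemble (M : Model H G) (x₁ x₃ : V) (x₁∈ : X M w₁ x₁ ≡ true) (x₃∈ : X M w₃ x₃ ≡ true)
                  (x₁-sees : HasNbrIn (X M u) x₁) (x₃-sees : HasNbrIn (X M u) x₃)
                  (ps : List V) (induced : Induced x₁ ps) (ends : lastOf x₁ ps ≡ x₃)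
                  (path-in : ∀ {v} → v ∈ x₁ ∷ ps → InPetal M v)
                  (b : V) (Lb : List V) (b∈path : b ∈ x₁ ∷ ps) (b∈ : X M w₂ b ≡ true)
                  (Lb∈ : All (λ t → X M w₂ t ≡ true) Lb) (Lb∉path : ∀ {t} → t ∈ Lb → t ∉ x₁ ∷ ps)
                  (b→u : PathTo (HasNbrIn (X M u)) b Lb) where

    b∈ps : b ∈ ps
    b∈ps = [ (λ { refl → ⊥-elim (≡true⇒≢false x₁∈ (disjoint-at M (w₁≢w₂ ∘ sym) b∈)) }) , (λ i → i) ]′
             (Any.toSum b∈path)

    b≢x₃ : b ≢ lastOf x₁ ps
    b≢x₃ e = ≡true⇒≢false x₃∈ (disjoint-at M w₂≢w₃ (subst (λ v → X M w₂ v ≡ true) (trans e ends) b∈))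

    at-b : Split (HasNbrIn (X M u)) (x₁ ∷ ps) b
    at-b = split x₁ ps [] induced (subst (HasNbrIn (X M u)) (sym ends) x₃-sees) (done x₁-sees) []
                 (here refl) there (λ ()) b∈ps b≢x₃

    open Split at-b

    E : List V
    E = La ++ Lb ++ Lc

    ∈E⁻ : ∀ {v} → v ∈ E → v ∈ La ⊎ v ∈ Lb ⊎ v ∈ Lc
    ∈E⁻ i = map₂ (∈-++⁻ Lb) (∈-++⁻ La i)

    ∉E : ∀ {v} → v ∉ La → v ∉ Lb → v ∉ Lc → v ∉ E
    ∉E v∉La v∉Lb v∉Lc i = [ v∉La , [ v∉Lb , v∉Lc ]′ ]′ (∈E⁻ i)

    E-in : All (InPetal M) E
    E-in = All.tabulate λ i → [ path-in ∘ La⊆F , [ inj₂ ∘ inj₁ ∘ All.lookup Lb∈ , path-in ∘ Lc⊆F ]′ ]′ (∈E⁻ i)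

    E→u : ∀ t → t ∈ E → Σ (List V) λ T → PathTo (HasNbrIn (X M u)) t T × T ⊆ E
    E→u t i with ∈E⁻ i
    ... | inj₁ j = let T , P , T⊆ = PathTo-suffix a→Q j in T , P , ∈-++⁺ˡ ∘ T⊆
    ... | inj₂ (inj₁ j) = let T , P , T⊆ = PathTo-suffix b→u j in T , P , ∈-++⁺ʳ La ∘ ∈-++⁺ˡ ∘ T⊆
    ... | inj₂ (inj₂ j) = let T , P , T⊆ = PathTo-suffix c→Q j in T , P , ∈-++⁺ʳ La ∘ ∈-++⁺ʳ Lb ∘ T⊆

    cut : Cut M
    cut = record
      { a = a ; b = b ; c = c ; E = E
      ; a-in = path-in a∈F ; b-in = inj₂ (inj₁ b∈) ; c-in = path-in c∈F ; E-in = E-in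
      ; a~b = a~b ; b~c = b~c ; a≁c = a≁c ; a≢b = a≢b ; b≢c = b≢c ; a≢c = a≢c
      ; a∉E = ∉E a∉La (λ k → Lb∉path k a∈F) a∉Lc
      ; b∉E = ∉E b∉La (λ k → Lb∉path k b∈path) b∉Lc
      ; c∉E = ∉E c∉La (λ k → Lb∉path k c∈F) c∉Lc
      ; E→u = E→u
      ; a-sees-u = PathTo⇒sees-∪ a→Q ∈-++⁺ˡ
      ; b-sees-u = PathTo⇒sees-∪ b→u (∈-++⁺ʳ La ∘ ∈-++⁺ˡ)
      ; c-sees-u = PathTo⇒sees-∪ c→Q (∈-++⁺ʳ La ∘ ∈-++⁺ʳ Lb)
      }

  path-meets-w₂ : ∀ (M : Model H G) {x₁ x₃} → X M w₁ x₁ ≡ true → X M w₃ x₃ ≡ true → ∀ ps → Induced x₁ ps →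
                  lastOf x₁ ps ≡ x₃ → (∀ {v} → v ∈ ps → X M w₂ v ≡ true ⊎ v ≡ x₃) →
                  Σ V λ p → p ∈ ps × X M w₂ p ≡ true
  path-meets-w₂ M x₁∈ x₃∈ [] _ refl _ = ⊥-elim (≡true⇒≢false x₁∈ (disjoint-at M (w₁≢w₃ ∘ sym) x₃∈))
  path-meets-w₂ M {x₁} {x₃} x₁∈ x₃∈ (p ∷ ps) (ext x₁~p _ _ _) _ ps-in with ps-in (here refl)
  ... | inj₁ p∈ = p , here refl , p∈
  ... | inj₂ refl = ⊥-elim (≡true⇒≢false (to (edges M w₁ w₃ w₁≢w₃) (x₁ , p , x₁∈ , x₃∈ , x₁~p)) w₁≁w₃)

  triangulate : (M : Model H G) → Singleton G (X M w₁) → Singleton G (X M w₃) → Triangulated M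
  triangulate M s₁ s₃
    with from (edges M w₁ w₂ w₁≢w₂) w₁~w₂ | from (edges M w₂ w₃ w₂≢w₃) w₂~w₃ | from (edges M w₂ u w₂≢u) w₂~u
  ... | x₁ , b₁ , x₁∈ , b₁∈ , x₁~b₁ | b₃ , x₃ , b₃∈ , x₃∈ , b₃~x₃ | d , d′ , d∈ , d′∈ , d~d′
    with walk⇒induced (step x₁~b₁ (∨-trueˡ b₁∈)
                        (walk-++ (walk-mono (λ _ → ∨-trueˡ) (connected M w₂ b₁ b₃ b₁∈ b₃∈))
                                 (step b₃~x₃ (∨-trueʳ (X M w₂ x₃) (∈｛｝ x₃)) here)))
  ... | ps , induced , ends , ps-in
    with path-meets-w₂ M x₁∈ x₃∈ ps induced ends ps∈
    where
      ps∈ : ∀ {v} → v ∈ ps → X M w₂ v ≡ true ⊎ v ≡ x₃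
      ps∈ i = map₂ (∈｛｝⁻ {x₃}) (∨-true⁻ (X M w₂ _) (All.lookup ps-in i))
  ... | p , p∈ps , p∈
    with lastVisit-on (_∈? x₁ ∷ ps) p∈ (connected M w₂ p d p∈ d∈) (there p∈ps) (d′ , d′∈ , d~d′)
  ... | lastVisit b Lb b∈path b∈ Lb∈ Lb∉path b→u = surgery M (Assemble.cut M x₁ x₃ x₁∈ x₃∈
          (Singleton-Touching s₁ x₁∈ (from (edges M w₁ u w₁≢u) w₁~u))
          (Singleton-Touching s₃ x₃∈ (from (edges M w₃ u w₃≢u) w₃~u))
          ps induced ends path-in b Lb b∈path b∈ Lb∈ (λ i → All.lookup Lb∉path i) b→u)
    where
      path-in : ∀ {v} → v ∈ x₁ ∷ ps → InPetal M v
      path-in (here refl) = inj₁ x₁∈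
      path-in {v} (there i) with ∨-true⁻ (X M w₂ v) (All.lookup ps-in i)
      ... | inj₁ v∈ = inj₂ (inj₁ v∈)
      ... | inj₂ v≡x₃ with ∈｛｝⁻ {x₃} {v} v≡x₃
      ...   | refl = inj₂ (inj₂ x₃∈)

  shrink-triangle : (M : Model H G) → Triangulated M
  shrink-triangle M = after-w₁ (shrink-deg≤2 M w₁ w₂ u (w₁≢w₂ ∘ sym) (w₁≢u ∘ sym) w₁~w₂ w₁~u nbrs₁)
    where
      after-w₃ : ∀ {M₁} → Singleton G (X M₁ w₁) → (∀ z → z ≢ w₁ → z ≢ w₂ → X M₁ z ≗ X M z) →
                 Shrunk M₁ w₃ w₂ u → Triangulated M
      after-w₃ {M₁} s₁ same₁ (M₂ , s₃ , same₂ , _) =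
        finish (triangulate M₂ (Singleton-cong {X M₂ w₁} {X M₁ w₁} (same₂ w₁ w₁≢w₃ w₁≢w₂) s₁) s₃)
        where
          finish : Triangulated M₂ → Triangulated M
          finish (M₃ , t₁ , t₂ , t₃ , same₃) = M₃ , t₁ , t₂ , t₃ , unchanged
            where
              unchanged : ∀ {z} → Outside z → X M₃ z ≗ X M z
              unchanged {z} o@(z≢w₁ , z≢w₂ , z≢w₃ , _) v =
                trans (same₃ o v) (trans (same₂ z z≢w₃ z≢w₂ v) (same₁ z z≢w₁ z≢w₂ v))
      after-w₁ : Shrunk M w₁ w₂ u → Triangulated M
      after-w₁ (M₁ , s₁ , same₁ , _) =
        after-w₃ {M₁} s₁ same₁ (shrink-deg≤2 M₁ w₃ w₂ u w₂≢w₃ (w₃≢u ∘ sym) (adj-sym H w₂~w₃) w₃~u nbrs₃)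

module Flower {H : Graph} {u : Fin (n H)} (FS : FlowerStructure H u) (G : Graph) where
  open FlowerStructure FS
  open Models H G
  open DecMembership (_≟_ {n H}) using () renaming (_∈?_ to _∈?ᴴ_)

  PetalShrunk : Model H G → List VH → Set
  PetalShrunk M p = Σ (Model H G) λ M′ → (∀ z → z ∈ p → Singleton G (X M′ z))
                    × (∀ z → z ∉ p → z ≢ u → X M′ z ≗ X M z)

  shrink-petal : (M : Model H G) {p : List VH} → p ∈ paths → PetalShrunk M p
  shrink-petal M {p} p∈ with All.lookup petals p∈
  ... | inj₂ ends = PathPetal.shrink-from FS G p∈ ends M [] p refl (λ _ ())
  shrink-petal M {w₁ ∷ w₂ ∷ w₃ ∷ []} p∈ | inj₁ (refl , u~p) = shrunk (shrink-triangle M)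
    where
      open TriangleSurgery H G (Petal.triangle FS p∈ refl u~p) using (Triangulated; shrink-triangle)
      shrunk : Triangulated M → PetalShrunk M (w₁ ∷ w₂ ∷ w₃ ∷ [])
      shrunk (M′ , s₁ , s₂ , s₃ , same) =
        M′ , (λ { z (here refl) → s₁ ; z (there (here refl)) → s₂ ; z (there (there (here refl))) → s₃ }) ,
        λ z z∉ z≢u → same (z∉ ∘ here , z∉ ∘ there ∘ here , z∉ ∘ there ∘ there ∘ here , z≢u)

  shrink-petals : (qs : List (List VH)) → qs ⊆ paths → (M : Model H G) →
                  (∀ z → z ≢ u → z ∉ concat qs → Singleton G (X M z)) →
                  Σ (Model H G) λ M′ → ∀ z → z ≢ u → Singleton G (X M′ z)
  shrink-petals [] _ M single = M , λ z z≢u → single z z≢u (λ ())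
  shrink-petals (q ∷ qs) qs⊆ M single = continue (shrink-petal M (qs⊆ (here refl)))
    where
      continue : PetalShrunk M q → Σ (Model H G) λ M′ → ∀ z → z ≢ u → Singleton G (X M′ z)
      continue (M₁ , q-single , same) = shrink-petals qs (qs⊆ ∘ there) M₁ single₁
        where
          single₁ : ∀ z → z ≢ u → z ∉ concat qs → Singleton G (X M₁ z)
          single₁ z z≢u z∉ with z ∈?ᴴ q
          ... | yes z∈q = q-single z z∈q
          ... | no z∉q = Singleton-cong (same z z∉q z≢u) (single z z≢u ([ z∉q , z∉ ]′ ∘ ∈-++⁻ q))

lemma3p6 : (H : Graph) (u : Fin (n H)) → IsFlower H u → NonTrivial H (λ w → w ≡ u)
lemma3p6 H u FS G M = Flower.shrink-petals FS G paths (λ i → i) M (λ z z≢u z∉ → ⊥-elim (z∉ (cover z z≢u)))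
  where open FlowerStructure FS
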